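{- Let $\mathcal{C}$ be a clustering of the terminals of a Steiner forest instance $(\mathcal{M},\mathcal{D})$, let $S,T\in\mathcal{C}$ be two distinct active supernodes, and let $\mathcal{C}'$ be the clustering obtained from $\mathcal{C}$ by replacing $S,T$ with $S\cup T$. Then (1) for every active supernode $U\in\mathcal{C}$ with $U\neq S,T$, the $\mathcal{C}'$-punctured distance from $U$ to its closest active supernode in $\mathcal{C}'$ is at least the $\mathcal{C}$-punctured distance from $U$ to its closest active supernode in $\mathcal{C}$; and (2) if $S\cup T$ is active in $\mathcal{C}'$, then the $\mathcal{C}'$-punctured distance from $S\cup T$ to its closest other supernode in $\mathcal{C}'$ is at least the minimum of the $\mathcal{C}$-punctured distances from $S$ and from $T$ to their respective closest other supernodes in $\mathcal{C}$.
   Context: A Steiner forest instance $(\mathcal{M},\mathcal{D})$: a finite metric space $\mathcal{M}=(V,d)$ and a set $\mathcal{D}$ of pairwise disjoint pairs $\{u,\bar u\}\subseteq V$ (terminals; $\bar u$ is the mate of $u$). A clustering is a partition of the terminals into sets called supernodes. For a clustering $\mathcal{C}$, let $G_{\mathcal{C}}$ be the complete graph on $V$ in which edge $\{x,y\}$ has length $0$ if $x,y$ are terminals in the same supernode and $d(x,y)$ otherwise; the $\mathcal{C}$-punctured distance $d_{\mathcal{M}/\mathcal{C}}$ is the shortest-path distance in $G_{\mathcal{C}}$, extended to supernodes by $d_{\mathcal{M}/\mathcal{C}}(S_1,S_2)=\min_{u\in S_1,v\in S_2}d_{\mathcal{M}/\mathcal{C}}(u,v)$. A terminal $u$ is active if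 its supernode does not contain $\bar u$; a supernode is active if it contains an active terminal.
   Formalization: The metric $d$ of the Steiner forest instance takes rational values. -}

module Defs where

open import Data.Nat using (ℕ; _≡ᵇ_)
open import Data.Fin using (Fin)
open import Data.Bool using (Bool; true; false; if_then_else_; _∧_)
open import Data.Maybe using (Maybe; just; nothing; is-just)
open import Data.Rational using (ℚ; 0ℚ; _+_; _≤_; _<_)
open import Data.Product using (Σ; ∃; ∃-syntax; _×_; _,_)
open import Relation.Binary.PropositionalEquality using (_≡_; _≢_)

-- A Steiner forest instance on the finite point set Fin n, with a
-- (rational-valued) metric d and the demand pairs given by a partial
-- fixed-point-free involution `mate` (mate u ≡ just ū iff {u,ū} ∈ 𝒟).
record SFInstance (n : ℕ) : Set where
  field
    d        : Fin n → Fin n → ℚ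
    d-refl   : ∀ x → d x x ≡ 0ℚ
    d-pos    : ∀ x y → x ≢ y → 0ℚ < d x y
    d-sym    : ∀ x y → d x y ≡ d y x
    d-tri    : ∀ x y z → d x z ≤ d x y + d y z
    mate     : Fin n → Maybe (Fin n)
    mate-inv : ∀ u v → mate u ≡ just v → mate v ≡ just u
    mate-irr : ∀ u → mate u ≢ just u

module _ {n : ℕ} (I : SFInstance n) where
  open SFInstance I

  Terminal : Fin n → Set
  Terminal u = ∃[ v ] (mate u ≡ just v)

  -- A clustering: each terminal gets a label; supernodes are the label
  -- classes of terminals (labels of non-terminals are irrelevant).
  Clustering : Set
  Clustering = Fin n → ℕ

  InSN : Clustering → ℕ → Fin n → Set
  InSN C ℓ x = Terminal x × C x ≡ ℓ

  IsSN : Clustering → ℕ → Set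
  IsSN C ℓ = ∃[ x ] InSN C ℓ x

  ActiveTerm : Clustering → Fin n → Set
  ActiveTerm C u = ∃[ v ] (mate u ≡ just v × C v ≢ C u)

  ActiveSN : Clustering → ℕ → Set
  ActiveSN C ℓ = ∃[ u ] (InSN C ℓ u × ActiveTerm C u)

  edge : Clustering → Fin n → Fin n → ℚ
  edge C x y =
    if is-just (mate x) ∧ is-just (mate y) ∧ (C x ≡ᵇ C y) then 0ℚ else d x y

  data Walk : Fin n → Fin n → Set where
    [] : ∀ {x} → Walk x x
    _∷_ : ∀ {x z} (y : Fin n) → Walk y z → Walk x z

  walkLen : Clustering → ∀ {x y} → Walk x y → ℚ
  walkLen C [] = 0ℚ
  walkLen C {x} (y ∷ w) = edge C x y + walkLen C w

  IsPDist : Clustering → Fin n → Fin n → ℚ → Set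
  IsPDist C x y r =
    (Σ (Walk x y) λ w → walkLen C w ≡ r) × (∀ (w : Walk x y) → r ≤ walkLen C w)

  IsSetDist : Clustering → ℕ → ℕ → ℚ → Set
  IsSetDist C ℓ₁ ℓ₂ r =
    (∃[ u ] ∃[ v ] (InSN C ℓ₁ u × InSN C ℓ₂ v × IsPDist C u v r)) ×
    (∀ u v r' → InSN C ℓ₁ u → InSN C ℓ₂ v → IsPDist C u v r' → r ≤ r')

  ClosestActive : Clustering → ℕ → ℚ → Set
  ClosestActive C ℓ r =
    (∃[ m ] (ActiveSN C m × m ≢ ℓ × IsSetDist C ℓ m r)) ×
    (∀ m r' → ActiveSN C m → m ≢ ℓ → IsSetDist C ℓ m r' → r ≤ r')

  ClosestOther : Clustering → ℕ → ℚ → Set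
  ClosestOther C ℓ r =
    (∃[ m ] (IsSN C m × m ≢ ℓ × IsSetDist C ℓ m r)) ×
    (∀ m r' → IsSN C m → m ≢ ℓ → IsSetDist C ℓ m r' → r ≤ r')

merge : ∀ {n} → ℕ → ℕ → (Fin n → ℕ) → (Fin n → ℕ)
merge s t C x = if C x ≡ᵇ t then s else C x

{-# OPTIONS --safe #-}
module Submission where

-- Merging S and T only zeroes edges between two terminals of S ∪ T, so a walk keeps its
-- length up to its first visit to S ∪ T and after its last one.  A shortest walk in C'
-- from U ∉ {S, T} to an active supernode thus has a prefix of unchanged length ending in S,
-- in T (both active in C), or at its endpoint, whose supernode was already active in C;
-- a shortest walk in C' leaving S ∪ T has a suffix of unchanged length starting in S or T.
-- Punctured distances exist since removing loops never lengthens a walk, so it suffices to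
-- minimise over walks of fewer than n steps, which a Bellman–Ford recursion does.

open import Defs
open import Data.Bool using (true; false; if_then_else_; _∧_)
open import Data.Bool.Properties using (⇔→≡; T-≡)
open import Data.Empty using (⊥-elim)
open import Data.Fin using (Fin; _≟_)
open import Data.Fin.Properties using (injective⇒≤)
open import Data.List using (List; map; filter; cartesianProduct; allFin)
open import Data.List.Membership.Propositional using () renaming (_∈_ to _∈ₗ_)
open import Data.List.Membership.Propositional.Properties
  using (∈-allFin; ∈-filter⁺; ∈-filter⁻; ∈-cartesianProduct⁺)
import Data.List.Relation.Unary.All as ListAll
open import Data.List.Relation.Unary.All.Properties using (map⁻)
open import Data.Maybe using (just; nothing; is-just)
open import Data.Nat using (ℕ; zero; suc; _≡ᵇ_; z≤n; s≤s) renaming (_≤_ to _≤ℕ_; _<_ to _<ℕ_)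
open import Data.Nat.Properties using (≡ᵇ⇒≡; ≡⇒≡ᵇ) renaming (_≟_ to _≟ℕ_; <⇒≤ to <⇒≤ℕ)
open import Data.Product using (Σ; ∃; ∃-syntax; _×_; _,_; proj₂; uncurry)
open import Data.Rational using (ℚ; 0ℚ; _+_; _≤_; _⊓_)
open import Data.Rational.Properties
  using (≤-refl; ≤-trans; ≤-reflexive; <⇒≤; +-mono-≤; +-monoʳ-≤; +-identityˡ; p⊓q≤p; p⊓q≤q; ≤-decTotalOrder)
open import Data.Sum using (_⊎_; inj₁; inj₂; [_,_]′) renaming (map to ⊎-map)
open import Data.Vec using (Vec; []; _∷_)
open import Data.Vec.Membership.Propositional using (_∈_; _∉_)
open import Data.Vec.Relation.Unary.All using (All; []; _∷_)
open import Data.Vec.Relation.Unary.Any using (here; there; any?)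
open import Data.Vec.Relation.Unary.Unique.Propositional using (Unique; []; _∷_; tail)
open import Data.Vec.Relation.Unary.Unique.Propositional.Properties using (lookup-injective)
open import Function using (_∘_; id; _⇔_; mk⇔; Equivalence)
open import Relation.Binary.Bundles using (DecTotalOrder)
open import Relation.Nullary using (¬_; yes; no)
open import Relation.Nullary.Decidable using (_×-dec_)
open import Relation.Unary using (Decidable)
open import Relation.Binary.PropositionalEquality using (_≡_; _≢_; refl; sym; trans; cong; cong₂; subst)
open import Data.List.Extrema (DecTotalOrder.totalOrder ≤-decTotalOrder)
  using (argmin; argmin-sel; f[argmin]≤f[⊤]; f[argmin]≤f[xs])

p≤q⇒p≤r+q : ∀ {p q r} → 0ℚ ≤ r → p ≤ q → p ≤ r + q
p≤q⇒p≤r+q {p} 0≤r p≤q = ≤-trans (≤-reflexive (sym (+-identityˡ p))) (+-mono-≤ 0≤r p≤q)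

≡ᵇ-resp-⇔ : ∀ {a b c d} → (a ≡ b ⇔ c ≡ d) → (a ≡ᵇ b) ≡ (c ≡ᵇ d)
≡ᵇ-resp-⇔ {a} {b} {c} {d} a≡b⇔c≡d = ⇔→≡ {z = true} (mk⇔
  (reflect c d ∘ Equivalence.to a≡b⇔c≡d ∘ reify a b)
  (reflect a b ∘ Equivalence.from a≡b⇔c≡d ∘ reify c d))
  where
  reify : ∀ m n → (m ≡ᵇ n) ≡ true → m ≡ n
  reify m n = ≡ᵇ⇒≡ m n ∘ Equivalence.from T-≡
  reflect : ∀ m n → m ≡ n → (m ≡ᵇ n) ≡ true
  reflect m n = Equivalence.to T-≡ ∘ ≡⇒≡ᵇ m n

∉⇒All≢ : ∀ {A : Set} {k} {x : A} {xs : Vec A k} → x ∉ xs → All (x ≢_) xs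
∉⇒All≢ {xs = []} _ = []
∉⇒All≢ {xs = _ ∷ _} x∉ = x∉ ∘ here ∷ ∉⇒All≢ (x∉ ∘ there)

∃-minimiser : ∀ {A : Set} {P : A → Set} → Decidable P → (xs : List A) → (∀ a → a ∈ₗ xs) →
  (f : A → ℚ) → ∀ {a} → P a → ∃[ i ] (P i × ∀ {j} → P j → f i ≤ f j)
∃-minimiser {A} {P} P? xs complete f {a} Pa = i , Pi , minimal
  where
  candidates : List A
  candidates = filter P? xs
  i : A
  i = argmin f a candidates
  Pi : P i
  Pi = [ (λ i≡a → subst P (sym i≡a) Pa) , proj₂ ∘ ∈-filter⁻ P? {xs = xs} ]′
         (argmin-sel f a candidates)
  minimal : ∀ {j} → P j → f i ≤ f j
  minimal Pj = ListAll.lookup (f[argmin]≤f[xs] a candidates) (∈-filter⁺ P? (complete _) Pj)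

module _ {n : ℕ} (I : SFInstance n) where
  open SFInstance I

  d-nonneg : ∀ x y → 0ℚ ≤ d x y
  d-nonneg x y with x ≟ y
  ... | yes refl = ≤-reflexive (sym (d-refl x))
  ... | no x≢y = <⇒≤ (d-pos x y x≢y)

  terminal? : Decidable (Terminal I)
  terminal? x with mate x
  ... | just v = yes (v , refl)
  ... | nothing = no λ ()

  inSN? : ∀ C ℓ → Decidable (InSN I C ℓ)
  inSN? C ℓ x = terminal? x ×-dec (C x ≟ℕ ℓ)

  steps : ∀ {x y} → Walk I x y → ℕ
  steps [] = 0
  steps (_ ∷ w) = suc (steps w)

  vertices : ∀ {x y} (w : Walk I x y) → Vec (Fin n) (suc (steps w))
  vertices {x} [] = x ∷ []
  vertices {x} (_ ∷ w) = x ∷ vertices w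

  Simple : ∀ {x y} → Walk I x y → Set
  Simple w = Unique (vertices w)

  simple⇒steps<n : ∀ {x y} {w : Walk I x y} → Simple w → steps w <ℕ n
  simple⇒steps<n simple = injective⇒≤ (lookup-injective simple _ _)

  module _ (C : Clustering I) where

    edge-nonneg : ∀ x y → 0ℚ ≤ edge I C x y
    edge-nonneg x y = nonneg (is-just (mate x) ∧ is-just (mate y) ∧ (C x ≡ᵇ C y))
      where
      nonneg : ∀ b → 0ℚ ≤ (if b then 0ℚ else d x y)
      nonneg true = ≤-refl
      nonneg false = d-nonneg x y

    walkLen-nonneg : ∀ {x y} (w : Walk I x y) → 0ℚ ≤ walkLen I C w
    walkLen-nonneg [] = ≤-refl
    walkLen-nonneg {x} (z ∷ w) = p≤q⇒p≤r+q (edge-nonneg x z) (walkLen-nonneg w)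

    dropUntil : ∀ {x z y} (w : Walk I z y) → x ∈ vertices w →
      Σ (Walk I x y) λ w' → walkLen I C w' ≤ walkLen I C w × (Simple w → Simple w')
    dropUntil [] (here refl) = [] , ≤-refl , id
    dropUntil (v ∷ w) (here refl) = v ∷ w , ≤-refl , id
    dropUntil {z = z} (v ∷ w) (there x∈w) with dropUntil w x∈w
    ... | w' , w'≤w , simple = w' , p≤q⇒p≤r+q (edge-nonneg z v) w'≤w , simple ∘ tail

    removeLoops : ∀ {x y} (w : Walk I x y) →
      Σ (Walk I x y) λ w' → Simple w' × walkLen I C w' ≤ walkLen I C w
    removeLoops [] = [] , [] ∷ [] , ≤-refl
    removeLoops {x} (z ∷ w) with removeLoops w
    ... | w₁ , simple₁ , w₁≤w with any? (x ≟_) (vertices w₁)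
    ...   | no x∉w₁ = z ∷ w₁ , ∉⇒All≢ x∉w₁ ∷ simple₁ , +-monoʳ-≤ (edge I C x z) w₁≤w
    ...   | yes x∈w₁ with dropUntil w₁ x∈w₁
    ...     | w₂ , w₂≤w₁ , simple₂ =
              w₂ , simple₂ simple₁ , ≤-trans w₂≤w₁ (p≤q⇒p≤r+q (edge-nonneg x z) w₁≤w)

    shortestWithin : ℕ → ∀ x y → Walk I x y
    stepThenShortest : ℕ → ∀ x y → List (Walk I x y)

    shortestWithin zero x y with x ≟ y
    ... | yes refl = []
    ... | no _ = y ∷ []
    shortestWithin (suc k) x y = argmin (walkLen I C) (shortestWithin k x y) (stepThenShortest k x y)

    stepThenShortest k x y = map (λ z → z ∷ shortestWithin k z y) (allFin n)

    shortestWithin-minimal : ∀ k {x y} (w : Walk I x y) → steps w ≤ℕ k →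
      walkLen I C (shortestWithin k x y) ≤ walkLen I C w
    shortestWithin-minimal zero {x} [] _ with x ≟ x
    ... | yes refl = ≤-refl
    ... | no x≢x = ⊥-elim (x≢x refl)
    shortestWithin-minimal (suc k) {x} [] _ =
      ≤-trans (f[argmin]≤f[⊤] {f = walkLen I C} (shortestWithin k x x) (stepThenShortest k x x))
              (shortestWithin-minimal k [] z≤n)
    shortestWithin-minimal (suc k) {x} (z ∷ w) (s≤s w≤k) =
      ≤-trans (ListAll.lookup (map⁻ (f[argmin]≤f[xs] {f = walkLen I C}
                                       (shortestWithin k x _) (stepThenShortest k x _))) (∈-allFin z))
              (+-monoʳ-≤ (edge I C x z) (shortestWithin-minimal k w w≤k))

    pdist : Fin n → Fin n → ℚ
    pdist x y = walkLen I C (shortestWithin n x y)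

    pdist-minimal : ∀ {x y} (w : Walk I x y) → pdist x y ≤ walkLen I C w
    pdist-minimal w with removeLoops w
    ... | w' , simple , w'≤w =
      ≤-trans (shortestWithin-minimal n w' (<⇒≤ℕ (simple⇒steps<n simple))) w'≤w

    pdist-isPDist : ∀ x y → IsPDist I C x y (pdist x y)
    pdist-isPDist x y = (shortestWithin n x y , refl) , pdist-minimal

    setDist-exists : ∀ {ℓ₁ ℓ₂} → IsSN I C ℓ₁ → IsSN I C ℓ₂ → ∃ (IsSetDist I C ℓ₁ ℓ₂)
    setDist-exists {ℓ₁} {ℓ₂} (a , a∈ℓ₁) (b , b∈ℓ₂)
      with ∃-minimiser inPair? pairs complete (uncurry pdist) (a∈ℓ₁ , b∈ℓ₂)
      where
      inPair? : Decidable (uncurry λ u v → InSN I C ℓ₁ u × InSN I C ℓ₂ v)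
      inPair? (u , v) = inSN? C ℓ₁ u ×-dec inSN? C ℓ₂ v
      pairs : List (Fin n × Fin n)
      pairs = cartesianProduct (allFin n) (allFin n)
      complete : ∀ uv → uv ∈ₗ pairs
      complete (u , v) = ∈-cartesianProduct⁺ (∈-allFin u) (∈-allFin v)
    ... | (u , v) , (u∈ℓ₁ , v∈ℓ₂) , minimal =
      pdist u v , (u , v , u∈ℓ₁ , v∈ℓ₂ , pdist-isPDist u v) ,
      λ { u' v' r u'∈ℓ₁ v'∈ℓ₂ ((w , w≡r) , _) →
            ≤-trans (minimal (u'∈ℓ₁ , v'∈ℓ₂)) (subst (pdist u' v' ≤_) w≡r (pdist-minimal w)) }

    setDist≤walkLen : ∀ {ℓ₁ ℓ₂ r u v} → IsSetDist I C ℓ₁ ℓ₂ r → InSN I C ℓ₁ u → InSN I C ℓ₂ v →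
      (w : Walk I u v) → r ≤ walkLen I C w
    setDist≤walkLen (_ , minimal) u∈ℓ₁ v∈ℓ₂ w =
      ≤-trans (minimal _ _ _ u∈ℓ₁ v∈ℓ₂ (pdist-isPDist _ _)) (pdist-minimal w)

    closestActive≤walkLen : ∀ {ℓ m r u v} → ClosestActive I C ℓ r → ActiveSN I C m → m ≢ ℓ →
      InSN I C ℓ u → InSN I C m v → (w : Walk I u v) → r ≤ walkLen I C w
    closestActive≤walkLen (_ , minimal) m-active m≢ℓ u∈ℓ v∈m w
      with setDist-exists (_ , u∈ℓ) (_ , v∈m)
    ... | R , isSetDist =
      ≤-trans (minimal _ R m-active m≢ℓ isSetDist) (setDist≤walkLen isSetDist u∈ℓ v∈m w)

    closestOther≤walkLen : ∀ {ℓ m r u v} → ClosestOther I C ℓ r → m ≢ ℓ →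
      InSN I C ℓ u → InSN I C m v → (w : Walk I u v) → r ≤ walkLen I C w
    closestOther≤walkLen (_ , minimal) m≢ℓ u∈ℓ v∈m w
      with setDist-exists (_ , u∈ℓ) (_ , v∈m)
    ... | R , isSetDist =
      ≤-trans (minimal _ R (_ , v∈m) m≢ℓ isSetDist) (setDist≤walkLen isSetDist u∈ℓ v∈m w)

relabel : ℕ → ℕ → ℕ → ℕ
relabel s t k = if k ≡ᵇ t then s else k

module _ {s t : ℕ} where

  relabel-t : relabel s t t ≡ s
  relabel-t rewrite Equivalence.to T-≡ (≡⇒≡ᵇ t t refl) = refl

  relabel-≡s : ∀ k → relabel s t k ≡ s → k ≡ s ⊎ k ≡ t
  relabel-≡s k k'≡s with k ≡ᵇ t in k≡ᵇt
  ... | true = inj₂ (≡ᵇ⇒≡ k t (Equivalence.from T-≡ k≡ᵇt))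
  ... | false = inj₁ k'≡s

  relabel-≢s : ∀ k → relabel s t k ≢ s → relabel s t k ≡ k
  relabel-≢s k k'≢s with k ≡ᵇ t
  ... | true = ⊥-elim (k'≢s refl)
  ... | false = refl

  relabel-≢s⇒≢t : ∀ k → relabel s t k ≢ s → k ≢ t
  relabel-≢s⇒≢t k k'≢s refl = k'≢s relabel-t

  relabel-injective : ∀ {j k} → relabel s t j ≢ s → relabel s t j ≡ relabel s t k → j ≡ k
  relabel-injective {j} {k} j'≢s j'≡k' =
    trans (sym (relabel-≢s j j'≢s)) (trans j'≡k' (relabel-≢s k (j'≢s ∘ trans j'≡k')))

module _ {n : ℕ} (I : SFInstance n) (C : Clustering I) (s t : ℕ) where
  open SFInstance I

  C' : Clustering I
  C' = merge s t C

  InS∪T : Fin n → Set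
  InS∪T = InSN I C' s

  Unchanged : ∀ {x y} → Walk I x y → Set
  Unchanged w = walkLen I C w ≡ walkLen I C' w

  PrefixToS∪T : ∀ {x y} → Walk I x y → Set
  PrefixToS∪T {x} w =
    ∃[ c ] Σ (Walk I x c) λ p → InS∪T c × Unchanged p × walkLen I C' p ≤ walkLen I C' w

  SuffixFromS∪T : ∀ {x y} → Walk I x y → Set
  SuffixFromS∪T {y = y} w =
    ∃[ c ] Σ (Walk I c y) λ q → InS∪T c × Unchanged q × walkLen I C' q ≤ walkLen I C' w

  inS∪T? : Decidable InS∪T
  inS∪T? = inSN? I C' s

  S∪T-split : ∀ {x} → InS∪T x → InSN I C s x ⊎ InSN I C t x
  S∪T-split {x} (x-term , x∈S∪T) = ⊎-map (x-term ,_) (x-term ,_) (relabel-≡s (C x) x∈S∪T)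

  ≢s⇒∉S∪T : ∀ {m x} → m ≢ s → InSN I C' m x → ¬ InS∪T x
  ≢s⇒∉S∪T m≢s (_ , x'≡m) (_ , x'≡s) = m≢s (trans (sym x'≡m) x'≡s)

  merge-InSN : ∀ {m x} → m ≢ s → InSN I C' m x → InSN I C m x
  merge-InSN {x = x} m≢s (x-term , x'≡m) =
    x-term , trans (sym (relabel-≢s (C x) (m≢s ∘ trans (sym x'≡m)))) x'≡m

  merge-≢t : ∀ {m x} → m ≢ s → InSN I C' m x → m ≢ t
  merge-≢t {x = x} m≢s x∈m@(_ , x'≡m) m≡t =
    relabel-≢s⇒≢t (C x) (m≢s ∘ trans (sym x'≡m)) (trans (proj₂ (merge-InSN m≢s x∈m)) m≡t)

  merge-ActiveSN : ∀ {m} → m ≢ s → ActiveSN I C' m → ActiveSN I C m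
  merge-ActiveSN m≢s (x , x∈m , y , x-mate , y'≢x') =
    x , merge-InSN m≢s x∈m , y , x-mate , y'≢x' ∘ cong (relabel s t)

  edge-merge : ∀ {x y} → ¬ InS∪T x ⊎ ¬ InS∪T y → edge I C x y ≡ edge I C' x y
  edge-merge {x} {y} outside = cong (λ b → if b then 0ℚ else d x y) (sameCluster outside)
    where
    sameCluster : ¬ InS∪T x ⊎ ¬ InS∪T y →
                  (is-just (mate x) ∧ is-just (mate y) ∧ (C x ≡ᵇ C y))
                ≡ (is-just (mate x) ∧ is-just (mate y) ∧ (C' x ≡ᵇ C' y))
    sameCluster _ with mate x | mate y
    sameCluster _ | nothing | _ = refl
    sameCluster _ | just _ | nothing = refl
    sameCluster (inj₁ x∉) | just u | just _ = ≡ᵇ-resp-⇔ {C x} {C y} (mk⇔ (cong (relabel s t))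
      (relabel-injective {s} {t} (λ x'≡s → x∉ ((u , refl) , x'≡s))))
    sameCluster (inj₂ y∉) | just _ | just v = ≡ᵇ-resp-⇔ {C x} {C y} (mk⇔ (cong (relabel s t))
      (sym ∘ relabel-injective {s} {t} (λ y'≡s → y∉ ((v , refl) , y'≡s)) ∘ sym))

  firstVisit : ∀ {x y} → ¬ InS∪T x → (w : Walk I x y) → PrefixToS∪T w ⊎ (¬ InS∪T y × Unchanged w)
  firstVisit x∉ [] = inj₂ (x∉ , refl)
  firstVisit {x} x∉ (z ∷ w) with inS∪T? z
  ... | yes z∈ = inj₁ (z , z ∷ [] , z∈ , cong (_+ 0ℚ) (edge-merge (inj₁ x∉)) ,
                       +-monoʳ-≤ (edge I C' x z) (walkLen-nonneg I C' w))
  ... | no z∉ with firstVisit z∉ w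
  ...   | inj₁ (c , p , c∈ , p≡ , p≤w) =
          inj₁ (c , z ∷ p , c∈ , cong₂ _+_ (edge-merge (inj₁ x∉)) p≡ , +-monoʳ-≤ (edge I C' x z) p≤w)
  ...   | inj₂ (y∉ , w≡) = inj₂ (y∉ , cong₂ _+_ (edge-merge (inj₁ x∉)) w≡)

  lastVisit : ∀ {x y} → ¬ InS∪T y → (w : Walk I x y) → SuffixFromS∪T w ⊎ (¬ InS∪T x × Unchanged w)
  lastVisit y∉ [] = inj₂ (y∉ , refl)
  lastVisit {x} y∉ (z ∷ w) with lastVisit y∉ w
  ... | inj₁ (c , q , c∈ , q≡ , q≤w) =
        inj₁ (c , q , c∈ , q≡ , p≤q⇒p≤r+q (edge-nonneg I C' x z) q≤w)
  ... | inj₂ (z∉ , w≡) with inS∪T? x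
  ...   | yes x∈ = inj₁ (x , z ∷ w , x∈ , cong₂ _+_ (edge-merge (inj₂ z∉)) w≡ , ≤-refl)
  ...   | no x∉ = inj₂ (x∉ , cong₂ _+_ (edge-merge (inj₁ x∉)) w≡)

  closestActive-merge : ActiveSN I C s → ActiveSN I C t → ∀ {u r r'} → u ≢ s → u ≢ t →
    ClosestActive I C u r → ClosestActive I C' u r' → r ≤ r'
  closestActive-merge s-active t-active {u} {r} u≢s u≢t closest
    ((m , m-active , m≢u , (a , b , a∈u , b∈m , (w , w≡r') , _) , _) , _) =
    subst (r ≤_) w≡r' (viaFirstVisit (firstVisit (≢s⇒∉S∪T u≢s a∈u) w))
    where
    a∈u₀ : InSN I C u a
    a∈u₀ = merge-InSN u≢s a∈u
    reach : ∀ {ℓ c} → ActiveSN I C ℓ → ℓ ≢ u → InSN I C ℓ c → (p : Walk I a c) → r ≤ walkLen I C p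
    reach ℓ-active ℓ≢u c∈ℓ = closestActive≤walkLen I C closest ℓ-active ℓ≢u a∈u₀ c∈ℓ
    viaFirstVisit : PrefixToS∪T w ⊎ (¬ InS∪T b × Unchanged w) → r ≤ walkLen I C' w
    viaFirstVisit (inj₁ (c , p , c∈S∪T , p≡ , p≤w)) =
      ≤-trans (≤-trans (viaS∪T (S∪T-split c∈S∪T)) (≤-reflexive p≡)) p≤w
      where
      viaS∪T : InSN I C s c ⊎ InSN I C t c → r ≤ walkLen I C p
      viaS∪T (inj₁ c∈s) = reach s-active (u≢s ∘ sym) c∈s p
      viaS∪T (inj₂ c∈t) = reach t-active (u≢t ∘ sym) c∈t p
    viaFirstVisit (inj₂ (b∉S∪T , w≡)) =
      ≤-trans (reach (merge-ActiveSN m≢s m-active) m≢u (merge-InSN m≢s b∈m) w) (≤-reflexive w≡)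
      where
      m≢s : m ≢ s
      m≢s refl = b∉S∪T b∈m

  closestOther-merge : ∀ {rS rT r'} →
    ClosestOther I C s rS → ClosestOther I C t rT → ClosestOther I C' s r' → rS ⊓ rT ≤ r'
  closestOther-merge {rS} {rT} closestS closestT
    ((m , _ , m≢s , (a , b , a∈S∪T , b∈m , (w , w≡r') , _) , _) , _)
    with lastVisit (≢s⇒∉S∪T m≢s b∈m) w
  ... | inj₂ (a∉S∪T , _) = ⊥-elim (a∉S∪T a∈S∪T)
  ... | inj₁ (c , q , c∈S∪T , q≡ , q≤w) =
    subst (rS ⊓ rT ≤_) w≡r' (≤-trans (≤-trans (viaS∪T (S∪T-split c∈S∪T)) (≤-reflexive q≡)) q≤w)
    where
    viaS∪T : InSN I C s c ⊎ InSN I C t c → rS ⊓ rT ≤ walkLen I C q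
    viaS∪T (inj₁ c∈s) = ≤-trans (p⊓q≤p rS rT)
      (closestOther≤walkLen I C closestS m≢s c∈s (merge-InSN m≢s b∈m) q)
    viaS∪T (inj₂ c∈t) = ≤-trans (p⊓q≤q rS rT)
      (closestOther≤walkLen I C closestT (merge-≢t m≢s b∈m) c∈t (merge-InSN m≢s b∈m) q)

claim3p2 : ∀ {n} (I : SFInstance n) (C : Clustering I) (s t : ℕ) →
    ActiveSN I C s → ActiveSN I C t → s ≢ t →
    (∀ u → ActiveSN I C u → u ≢ s → u ≢ t → ∀ r r' →
       ClosestActive I C u r → ClosestActive I (merge s t C) u r' → r ≤ r')
    ×
    (ActiveSN I (merge s t C) s → ∀ rS rT r' →
       ClosestOther I C s rS → ClosestOther I C t rT →
       ClosestOther I (merge s t C) s r' → rS ⊓ rT ≤ r')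
claim3p2 I C s t s-active t-active _ =
  (λ _ _ u≢s u≢t _ _ → closestActive-merge I C s t s-active t-active u≢s u≢t) ,
  (λ _ _ _ _ → closestOther-merge I C s t)
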